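{- For every $n\ge0$, the set $A_{\mathbb{Z}[i],n}$ is closed under complex conjugation.
   Context: For $M\subseteq\mathbb{Z}[i]$ and $\beta\in\mathbb{Z}[i]$, $M\twoheadrightarrow\mathbb{Z}[i]/\beta$ means every residue class of $\mathbb{Z}[i]/(\beta)$ has a representative in $M$. Motzkin sets: $A_{\mathbb{Z}[i],0}=\{0,\pm1,\pm i\}$, and for $j\ge1$, $A_{\mathbb{Z}[i],j}=A_{\mathbb{Z}[i],j-1}\cup\{\beta\in\mathbb{Z}[i]: A_{\mathbb{Z}[i],j-1}\twoheadrightarrow\mathbb{Z}[i]/\beta\}$. -}

module Defs where

open import Data.Nat using (ℕ; zero; suc)
open import Data.Integer using (ℤ; +_; -[1+_]; _+_; _*_; -_; _-_)
open import Data.Product using (Σ; _×_; _,_)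
open import Data.Sum using (_⊎_)
open import Relation.Binary.PropositionalEquality using (_≡_)

record ℤ[i] : Set where
  constructor _+_i
  field
    re : ℤ
    im : ℤ
open ℤ[i] public

infixl 6 _+ᵍ_ _-ᵍ_
infixl 7 _*ᵍ_

_+ᵍ_ : ℤ[i] → ℤ[i] → ℤ[i]
(a + b i) +ᵍ (c + d i) = (a + c) + (b + d) i

_-ᵍ_ : ℤ[i] → ℤ[i] → ℤ[i]
(a + b i) -ᵍ (c + d i) = (a - c) + (b - d) i

_*ᵍ_ : ℤ[i] → ℤ[i] → ℤ[i]
(a + b i) *ᵍ (c + d i) = (a * c - b * d) + (a * d + b * c) i

conj : ℤ[i] → ℤ[i]
conj (a + b i) = a + (- b) i

_∣ᵍ_ : ℤ[i] → ℤ[i] → Set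
β ∣ᵍ α = Σ ℤ[i] λ γ → α ≡ β *ᵍ γ

Subset : Set₁
Subset = ℤ[i] → Set

_↠mod_ : Subset → ℤ[i] → Set
M ↠mod β = (α : ℤ[i]) → Σ ℤ[i] λ m → M m × (β ∣ᵍ (α -ᵍ m))

A₀ : Subset
A₀ x = (x ≡ ((+ 0) + (+ 0) i)) ⊎ (x ≡ ((+ 1) + (+ 0) i)) ⊎ (x ≡ (-[1+ 0 ] + (+ 0) i))
     ⊎ (x ≡ ((+ 0) + (+ 1) i)) ⊎ (x ≡ ((+ 0) + -[1+ 0 ] i))

A : ℕ → Subset
A zero    = A₀
A (suc j) = λ β → A j β ⊎ (A j ↠mod β)

-- Conjugation is a ring automorphism of ℤ[i] fixing the set {0, ±1, ±i}, so it
-- preserves divisibility and carries a complete residue system modulo β to one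
-- modulo conj β. Induction on n then shows every A n is closed under conjugation.
module Submission where

open import Defs
open import Data.Nat using (ℕ; zero; suc)
open import Data.Integer using (ℤ; _+_; _*_; -_; _-_)
open import Data.Integer.Properties using (neg-involutive)
open import Data.Integer.Tactic.RingSolver using (solve-∀)
open import Data.Product using (_,_)
open import Data.Sum using (inj₁; inj₂)
open import Relation.Binary.PropositionalEquality

ConjClosed : Subset → Set
ConjClosed M = ∀ β → M β → M (conj β)

conj-involutive : ∀ x → conj (conj x) ≡ x
conj-involutive (a + b i) = cong (a +_i) (neg-involutive b)

conj-homo-− : ∀ x y → conj (x -ᵍ y) ≡ conj x -ᵍ conj y
conj-homo-− (a + b i) (c + d i) = cong ((a - c) +_i) (neg-distrib-− b d)
  where
  neg-distrib-− : ∀ (b d : ℤ) → - (b - d) ≡ (- b) - (- d)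
  neg-distrib-− = solve-∀

conj-homo-* : ∀ x y → conj (x *ᵍ y) ≡ conj x *ᵍ conj y
conj-homo-* (a + b i) (c + d i) = cong₂ _+_i (re-identity a b c d) (im-identity a b c d)
  where
  re-identity : ∀ (a b c d : ℤ) → a * c - b * d ≡ a * c - (- b) * (- d)
  re-identity = solve-∀
  im-identity : ∀ (a b c d : ℤ) → - (a * d + b * c) ≡ a * (- d) + (- b) * c
  im-identity = solve-∀

conj-∣ᵍ : ∀ β α → β ∣ᵍ α → conj β ∣ᵍ conj α
conj-∣ᵍ β _ (γ , α≡βγ) = conj γ , trans (cong conj α≡βγ) (conj-homo-* β γ)

conj-↠mod : ∀ {M β} → ConjClosed M → M ↠mod β → M ↠mod conj β
conj-↠mod {M} {β} closed M↠β α with M↠β (conj α)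
... | m , m∈M , β∣ᾱ-m =
  conj m , closed m m∈M , subst (conj β ∣ᵍ_) ᾱ-m̄≡α-m̄ (conj-∣ᵍ β (conj α -ᵍ m) β∣ᾱ-m)
  where
  ᾱ-m̄≡α-m̄ : conj (conj α -ᵍ m) ≡ α -ᵍ conj m
  ᾱ-m̄≡α-m̄ = begin
    conj (conj α -ᵍ m)      ≡⟨ conj-homo-− (conj α) m ⟩
    conj (conj α) -ᵍ conj m ≡⟨ cong (_-ᵍ conj m) (conj-involutive α) ⟩
    α -ᵍ conj m             ∎
    where open ≡-Reasoning

A₀-conjClosed : ConjClosed A₀
A₀-conjClosed _ (inj₁ refl)                      = inj₁ refl
A₀-conjClosed _ (inj₂ (inj₁ refl))               = inj₂ (inj₁ refl)
A₀-conjClosed _ (inj₂ (inj₂ (inj₁ refl)))        = inj₂ (inj₂ (inj₁ refl))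
A₀-conjClosed _ (inj₂ (inj₂ (inj₂ (inj₁ refl)))) = inj₂ (inj₂ (inj₂ (inj₂ refl)))
A₀-conjClosed _ (inj₂ (inj₂ (inj₂ (inj₂ refl)))) = inj₂ (inj₂ (inj₂ (inj₁ refl)))

lemma2p5 : (n : ℕ) (β : ℤ[i]) → A n β → A n (conj β)
lemma2p5 zero    = A₀-conjClosed
lemma2p5 (suc n) β (inj₁ β∈Aₙ) = inj₁ (lemma2p5 n β β∈Aₙ)
lemma2p5 (suc n) β (inj₂ Aₙ↠β) = inj₂ (conj-↠mod {A n} {β} (lemma2p5 n) Aₙ↠β)
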